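{- Let $P = (p_n)_{n<\omega}, Q = (q_m)_{m<\omega} \in \mathbf{FIN}_k^{[\infty]}$. If $p \in \langle P \rangle \cap \langle Q \rangle$ is intertwined, then for all $q \in \langle P \rangle \cap \langle Q \rangle$ there exist subblocks $s, r \in \langle P \rangle^* \cap \langle Q \rangle^*$ such that $s < p < r$ and $p \star q = s + p + r$.
   Context: Fix an integer $k \geq 1$. $\mathbf{FIN}_k$ is the set of all maps $p : \omega \to \{0,\dots,k\}$ whose support $\mathrm{supp}(p) = \{n : p(n) \neq 0\}$ is finite and such that $k \in \mathrm{ran}(p)$ (elements are called blocks). For maps $p,q$ with disjoint supports, $p+q$ is the map equal to $p$ on $\mathrm{supp}(p)$, to $q$ on $\mathrm{supp}(q)$, and $0$ elsewhere. The tetris operation is $T(p)(n) = \max\{p(n)-1,0\}$. For finitely supported maps $p,q$ (possibly with empty support), write $p < q$ if $\max\mathrm{supp}(p) < \min\mathrm{supp}(q)$, or $\mathrm{supp}(p) = \emptyset$, or $\mathrm{supp}(q) = \emptyset$. $\mathbf{FIN}_k^{[\infty]}$ is the set of infinite block sequences $P = (p_n)_{n<\omega}$ in $\mathbf{FIN}_k$ with $p_n < p_{n+1}$ for all $n$. For a finite block sequence $p_0 < \cdots < p_{N-1}$, $\langle p_0,\dots,p_{N-1} \rangle$ is the set of all $T^{j_0}(p_{n_0}) + \cdots + T^{j_m}(p_{n_m})$ with $n_0 < \cdots < n_m < N$, $j_0,\dots,j_m < k$ and $\min_i j_i = 0$; for infinite $P$, $\langle P \rangle = \bigcup_N \langle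 p_0,\dots,p_{N-1} \rangle$. A subblock is a map $T^i(p)$ with $p \in \mathbf{FIN}_k$, $i \geq 0$. $\langle p_0,\dots,p_{N-1}\rangle^* = \{T^i(p) : p \in \langle p_0,\dots,p_{N-1}\rangle, i \geq 0\}$ and $\langle P \rangle^* = \bigcup_{N<\omega} \langle p_0,\dots,p_{N-1} \rangle^*$. For $p,q \in \mathbf{FIN}_k$, $p \star q$ is the map $n \mapsto \max\{p(n),q(n)\}$. Intertwined blocks: given $p \in \langle P \rangle \cap \langle Q \rangle$, write $p = T^{i_0'}(p_{i_0}) + \cdots + T^{i_{n-1}'}(p_{i_{n-1}}) = T^{j_0'}(q_{j_0}) + \cdots + T^{j_{m-1}'}(q_{j_{m-1}})$ with $i_0 < \cdots < i_{n-1}$, $j_0 < \cdots < j_{m-1}$ and all exponents $< k$. Let $G_p$ be the bipartite graph with vertex set the disjoint union of $V_1 = \{i_0,\dots,i_{n-1}\}$ and $V_2 = \{j_0,\dots,j_{m-1}\}$, where $i_g \in V_1$ and $j_h \in V_2$ are adjacent iff $\mathrm{supp}(T^{i_g'}(p_{i_g})) \cap \mathrm{supp}(T^{j_h'}(q_{j_h})) \neq \emptyset$. The block $p$ is intertwined if $G_p$ is connected. -}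

module Defs where

open import Data.Nat using (ℕ; zero; suc; _+_; _∸_; _⊔_; _≤_; _<_)
open import Data.Fin using (Fin)
import Data.Fin as F
open import Data.Product using (Σ; ∃; ∃-syntax; _×_; _,_)
open import Data.Sum using (_⊎_; inj₁; inj₂)
open import Data.Empty using (⊥)
open import Relation.Binary.PropositionalEquality using (_≡_; _≢_)
open import Relation.Binary.Construct.Closure.ReflexiveTransitive using (Star)

-- Maps ω → ℕ (values in {0,…,k} are imposed by the predicates below).
Map : Set
Map = ℕ → ℕ

-- Iterated tetris operation: T^i(p)(n) = max(p(n) - i, 0).
T^ : ℕ → Map → Map
T^ i p n = p n ∸ i

-- Sum of maps: pointwise addition (agrees with p+q whenever supports are disjoint).
_⊕_ : Map → Map → Map
(p ⊕ q) n = p n + q n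

_⋆_ : Map → Map → Map
(p ⋆ q) n = p n ⊔ q n

_≐_ : Map → Map → Set
p ≐ q = ∀ n → p n ≡ q n

-- p < q : every element of supp(p) is below every element of supp(q)
-- (vacuous when one support is empty).
_≺_ : Map → Map → Set
p ≺ q = ∀ x y → p x ≢ 0 → q y ≢ 0 → x < y

IsBlock : ℕ → Map → Set
IsBlock k p = (∀ n → p n ≤ k) × (∃[ N ] (∀ n → N ≤ n → p n ≡ 0)) × (∃[ n ] p n ≡ k)

BlockSeq : ℕ → (ℕ → Map) → Set
BlockSeq k P = (∀ n → IsBlock k (P n)) × (∀ n → P n ≺ P (suc n))

sumF : (len : ℕ) → (Fin len → Map) → Map
sumF zero f n = 0
sumF (suc len) f n = f F.zero n + sumF len (λ a → f (F.suc a)) n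

-- A representation of p as T^{e_0}(P_{i_0}) + ⋯ + T^{e_{len-1}}(P_{i_{len-1}})
-- with i_0 < ⋯ < i_{len-1}, all e_a < k and min e_a = 0.
-- Such a representation exists iff p ∈ ⟨P⟩.
record Rep (k : ℕ) (P : ℕ → Map) (p : Map) : Set where
  field
    len     : ℕ
    idx     : Fin len → ℕ
    ex      : Fin len → ℕ
    idx-mono : ∀ a b → a F.< b → idx a < idx b
    ex<k    : ∀ a → ex a < k
    ex-min  : ∃[ a ] ex a ≡ 0
  term : Fin len → Map
  term a = T^ (ex a) (P (idx a))
  field
    eq      : p ≐ sumF len term

InSpan : ℕ → (ℕ → Map) → Map → Set
InSpan k P p = Rep k P p

InSpan* : ℕ → (ℕ → Map) → Map → Set
InSpan* k P s = ∃[ i ] ∃[ p ] (InSpan k P p × s ≐ T^ i p)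

-- The bipartite graph G_p: vertices are positions in the two representations.
Edge : ∀ {k P Q p} (rP : Rep k P p) (rQ : Rep k Q p) →
       Fin (Rep.len rP) ⊎ Fin (Rep.len rQ) → Fin (Rep.len rP) ⊎ Fin (Rep.len rQ) → Set
Edge rP rQ (inj₁ a) (inj₂ b) = ∃[ x ] (Rep.term rP a x ≢ 0 × Rep.term rQ b x ≢ 0)
Edge rP rQ (inj₂ b) (inj₁ a) = ∃[ x ] (Rep.term rP a x ≢ 0 × Rep.term rQ b x ≢ 0)
Edge rP rQ (inj₁ _) (inj₁ _) = ⊥
Edge rP rQ (inj₂ _) (inj₂ _) = ⊥

Connected : ∀ {k P Q p} → Rep k P p → Rep k Q p → Set
Connected rP rQ = ∀ u v → Star (Edge rP rQ) u v

-- p ∈ ⟨P⟩ ∩ ⟨Q⟩ is intertwined (representations are unique, so ∃ = ∀ here).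
Intertwined : ℕ → (ℕ → Map) → (ℕ → Map) → Map → Set
Intertwined k P Q p = Σ (Rep k P p) λ rP → Σ (Rep k Q p) λ rQ → Connected rP rQ

-- Every element of ⟨B⟩ coincides, on the convex hull of the support of a block B i, with a
-- tetris-iterate T^e(B i): the other blocks vanish there. So near each term T^e(f) of either
-- representation of p we have p = T^e(f) and q = T^e′(f). If e′ < e, then q > p on the whole
-- support of that term, and at a point shared with a neighbouring term of G_p this forces
-- e′ < e there too. Connectedness carries this to the term with e = 0, where q = T^e′(f) ≤ f = p,
-- a contradiction. Hence q ≤ p near every term, and since the terms chain across the hull of
-- supp p, q ≤ p on all of it; so p ⋆ q = s + p + r with s, r the parts of q left and right of
-- supp p. Each term of a representation of q lies on one side of a = min supp p: blocks other
-- than the one through a lie on one side of it, and the term on that block vanishes left of a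
-- because q ≤ p = 0 there. So s is a sum of whole terms, and factoring out the least exponent
-- exhibits it as a subblock; likewise for r.

module Submission where

open import Defs
open import Data.Nat using (ℕ; zero; suc; _+_; _∸_; _⊔_; _⊓_; _≤_; _<_; _≟_; _<?_; z≤n; s≤s)
open import Data.Nat.Properties
open import Data.Fin using (Fin; toℕ)
import Data.Fin as F
import Data.Fin.Properties as FP
open import Data.Product as Prod using (Σ-syntax; ∃-syntax; _×_; _,_; proj₁; proj₂)
open import Data.Sum as Sum using (_⊎_; inj₁; inj₂; [_,_])
open import Data.Unit using (⊤; tt)
open import Function using (_∘_; id)
open import Level using (0ℓ)
open import Relation.Binary using (Rel; tri<; tri≈; tri>)
open import Relation.Binary.PropositionalEquality
  using (_≡_; _≢_; refl; sym; trans; cong; cong₂; subst; subst₂; module ≡-Reasoning)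
open import Relation.Binary.Construct.Closure.ReflexiveTransitive using (Star; ε; _◅_)
open import Relation.Nullary using (¬_; yes; no; contradiction)
open import Relation.Nullary.Decidable using (decidable-stable)
open import Relation.Unary using (Pred; Decidable; _⊆_; ∁)

Supp : Map → Pred ℕ 0ℓ
Supp f x = f x ≢ 0

Hull : Map → Pred ℕ 0ℓ
Hull f x = (∃[ y ] (y ≤ x × f y ≢ 0)) × (∃[ y ] (x ≤ y × f y ≢ 0))

Finite : Map → Set
Finite f = ∃[ N ] (∀ x → N ≤ x → f x ≡ 0)

Disjoint : Map → Map → Set
Disjoint f g = ∀ x → f x ≡ 0 ⊎ g x ≡ 0

_↾_ : {D : Pred ℕ 0ℓ} → Map → Decidable D → Map
(f ↾ d) x with d x
... | yes _ = f x
... | no _ = 0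

supp⊆hull : ∀ {f : Map} → Supp f ⊆ Hull f
supp⊆hull {x = x} fx≢0 = (x , ≤-refl , fx≢0) , (x , ≤-refl , fx≢0)

≡0-outside : ∀ {f} {D : Pred ℕ 0ℓ} {x} → Supp f ⊆ D → ¬ D x → f x ≡ 0
≡0-outside {f} {x = x} supp⊆D ¬Dx = decidable-stable (f x ≟ 0) (¬Dx ∘ supp⊆D)

m≡0⇒m∸n≡0 : ∀ {m} n → m ≡ 0 → m ∸ n ≡ 0
m≡0⇒m∸n≡0 n refl = 0∸n≡0 n

m∸n≢0⇒m≢0 : ∀ {m} n → m ∸ n ≢ 0 → m ≢ 0
m∸n≢0⇒m≢0 n m∸n≢0 m≡0 = m∸n≢0 (m≡0⇒m∸n≡0 n m≡0)

T^-hull : ∀ {e f} → Hull (T^ e f) ⊆ Hull f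
T^-hull {e} ((y , y≤x , ty≢0) , (y′ , x≤y′ , ty′≢0)) =
  (y , y≤x , m∸n≢0⇒m≢0 e ty≢0) , (y′ , x≤y′ , m∸n≢0⇒m≢0 e ty′≢0)

T^-finite : ∀ e {f} → Finite f → Finite (T^ e f)
T^-finite e = Prod.map₂ (λ vanish x N≤x → m≡0⇒m∸n≡0 e (vanish x N≤x))

T^-T^ : ∀ {m e} f → m ≤ e → T^ m (T^ (e ∸ m) f) ≐ T^ e f
T^-T^ {m} {e} f m≤e x = trans (∸-+-assoc (f x) (e ∸ m) m) (cong (f x ∸_) (m∸n+n≡m m≤e))

T^-⊕ : ∀ m {f g} → Disjoint f g → T^ m (f ⊕ g) ≐ (T^ m f ⊕ T^ m g)
T^-⊕ m {f} {g} disjoint x with disjoint x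
... | inj₁ fx≡0 rewrite fx≡0 = sym (cong (_+ (g x ∸ m)) (0∸n≡0 m))
... | inj₂ gx≡0 rewrite gx≡0 | +-identityʳ (f x) =
  sym (trans (cong (f x ∸ m +_) (0∸n≡0 m)) (+-identityʳ _))

↾-zero : ∀ {D} (d : Decidable D) → ((λ _ → 0) ↾ d) ≐ (λ _ → 0)
↾-zero d x with d x
... | yes _ = refl
... | no _ = refl

↾-cong : ∀ {D f g} (d : Decidable D) → f ≐ g → (f ↾ d) ≐ (g ↾ d)
↾-cong d f≐g x with d x
... | yes _ = f≐g x
... | no _ = refl

↾-⊕-inside : ∀ {D f g} (d : Decidable D) → Supp f ⊆ D →
             ((f ⊕ g) ↾ d) ≐ (f ⊕ (g ↾ d))
↾-⊕-inside {f = f} d supp⊆D x with d x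
... | yes _ = refl
... | no ¬Dx = sym (cong (_+ 0) (≡0-outside {f} supp⊆D ¬Dx))

↾-⊕-outside : ∀ {D f g} (d : Decidable D) → Supp f ⊆ ∁ D → ((f ⊕ g) ↾ d) ≐ (g ↾ d)
↾-⊕-outside {f = f} {g} d supp⊆∁D x with d x
... | yes Dx = cong (_+ g x) (≡0-outside {f} supp⊆∁D λ ¬Dx → ¬Dx Dx)
... | no _ = refl

≺-trans : ∀ {f g h} → ∃[ y ] g y ≢ 0 → f ≺ g → g ≺ h → f ≺ h
≺-trans (y , gy≢0) f≺g g≺h x z fx≢0 hz≢0 =
  <-trans (f≺g x y fx≢0 gy≢0) (g≺h y z gy≢0 hz≢0)

sumF-≡0 : ∀ n (f : Fin n → Map) {x} → (∀ a → f a x ≡ 0) → sumF n f x ≡ 0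
sumF-≡0 zero f _ = refl
sumF-≡0 (suc n) f all≡0 = cong₂ _+_ (all≡0 F.zero) (sumF-≡0 n (f ∘ F.suc) (all≡0 ∘ F.suc))

sumF-single : ∀ n (f : Fin n → Map) {x} a →
              (∀ b → b ≢ a → f b x ≡ 0) → sumF n f x ≡ f a x
sumF-single (suc n) f {x} F.zero others =
  trans (cong (f F.zero x +_) (sumF-≡0 n (f ∘ F.suc) (λ b → others (F.suc b) λ ())))
        (+-identityʳ _)
sumF-single (suc n) f {x} (F.suc a) others =
  trans (cong (_+ sumF n (f ∘ F.suc) x) (others F.zero λ ()))
        (sumF-single n (f ∘ F.suc) a λ b b≢a → others (F.suc b) (b≢a ∘ FP.suc-injective))

sumF-nonzero : ∀ n (f : Fin n → Map) {x} → sumF n f x ≢ 0 → ∃[ a ] f a x ≢ 0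
sumF-nonzero n f {x} sum≢0 =
  FP.¬∀⟶∃¬ n (λ a → f a x ≡ 0) (λ a → f a x ≟ 0) (sum≢0 ∘ sumF-≡0 n f)

sumF-finite : ∀ n (f : Fin n → Map) → (∀ a → Finite (f a)) → Finite (sumF n f)
sumF-finite zero f _ = 0 , λ _ _ → refl
sumF-finite (suc n) f finite with finite F.zero | sumF-finite n (f ∘ F.suc) (finite ∘ F.suc)
... | N , vanishN | M , vanishM =
  N ⊔ M , λ x N⊔M≤x →
    cong₂ _+_ (vanishN x (m⊔n≤o⇒m≤o N M N⊔M≤x)) (vanishM x (m⊔n≤o⇒n≤o N M N⊔M≤x))

strictMono⇒injective : ∀ {n} {idx : Fin n → ℕ} → (∀ a b → a F.< b → idx a < idx b) →
                       ∀ {a b} → a ≢ b → idx a ≢ idx b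
strictMono⇒injective {idx = idx} mono {a} {b} a≢b with FP.<-cmp a b
... | tri< a<b _ _ = <⇒≢ (mono a b a<b)
... | tri≈ _ a≡b _ = contradiction a≡b a≢b
... | tri> _ _ b<a = >⇒≢ (mono b a b<a)

rep-supp : ∀ {k B m x} (r : Rep k B m) → m x ≢ 0 → ∃[ a ] Rep.term r a x ≢ 0
rep-supp r mx≢0 = sumF-nonzero (Rep.len r) (Rep.term r) (mx≢0 ∘ trans (Rep.eq r _))

InSpan*-resp : ∀ {k B s t} → t ≐ s → InSpan* k B s → InSpan* k B t
InSpan*-resp t≐s (i , p , p∈⟨B⟩ , s≐T^p) =
  i , p , p∈⟨B⟩ , λ x → trans (t≐s x) (s≐T^p x)

least-supp : (f : Map) {y : ℕ} → f y ≢ 0 → ∃[ a ] (f a ≢ 0 × ∀ x → x < a → f x ≡ 0)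
least-supp f {y} fy≢0
  with FP.¬∀⟶∃¬-smallest (suc y) (λ i → f (toℕ i) ≡ 0) (λ i → f (toℕ i) ≟ 0)
         (λ all≡0 → fy≢0 (subst (λ z → f z ≡ 0) (FP.toℕ-fromℕ y) (all≡0 (F.fromℕ y))))
... | i , fi≢0 , below =
  toℕ i , fi≢0 , λ x x<i → subst (λ z → f z ≡ 0)
    (trans (FP.toℕ-inject (F.fromℕ< x<i)) (FP.toℕ-fromℕ< x<i)) (below (F.fromℕ< x<i))

greatest-supp : (f : Map) (N : ℕ) → (∀ x → N ≤ x → f x ≡ 0) →
                ∀ {y} → f y ≢ 0 → ∃[ b ] (f b ≢ 0 × ∀ x → b < x → f x ≡ 0)
greatest-supp f zero vanish fy≢0 = contradiction (vanish _ z≤n) fy≢0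
greatest-supp f (suc N) vanish fy≢0 with f N ≟ 0
... | no fN≢0 = N , fN≢0 , vanish
... | yes fN≡0 = greatest-supp f N vanish′ fy≢0
  where
    vanish′ : ∀ x → N ≤ x → f x ≡ 0
    vanish′ x N≤x = [ vanish x , (λ { refl → fN≡0 }) ] (m≤n⇒m<n∨m≡n N≤x)

hull-along-path : ∀ {V : Set} {R : Rel V 0ℓ} (f : V → Map) →
                  (∀ {u w} → R u w → ∃[ z ] (f u z ≢ 0 × f w z ≢ 0)) →
                  ∀ {u v x} → Star R u v →
                  ∃[ y ] (y ≤ x × f u y ≢ 0) → ∃[ y ] (x ≤ y × f v y ≢ 0) →
                  ∃[ w ] Hull (f w) x
hull-along-path f overlaps {u} ε below above = u , below , above
hull-along-path f overlaps {u} {x = x} (edge ◅ path) below above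
  with overlaps edge
... | z , fuz≢0 , fwz≢0 with ≤-total z x
...   | inj₁ z≤x = hull-along-path f overlaps path (z , z≤x , fwz≢0) above
...   | inj₂ x≤z = u , below , (z , x≤z , fuz≢0)

module BlockSequence {k : ℕ} (1≤k : 1 ≤ k) {B : ℕ → Map} (BS : BlockSeq k B) where

  B≤k : ∀ i x → B i x ≤ k
  B≤k i = proj₁ (proj₁ BS i)

  B-finite : ∀ i → Finite (B i)
  B-finite i = proj₁ (proj₂ (proj₁ BS i))

  B-nonempty : ∀ i → ∃[ y ] B i y ≢ 0
  B-nonempty i with proj₂ (proj₂ (proj₁ BS i))
  ... | y , Biy≡k = y , λ Biy≡0 → <⇒≢ 1≤k (trans (sym Biy≡0) Biy≡k)

  ≺-mono : ∀ {i j} → i < j → B i ≺ B j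
  ≺-mono {i} {suc j} (s≤s i≤j) with m≤n⇒m<n∨m≡n i≤j
  ... | inj₁ i<j = ≺-trans (B-nonempty j) (≺-mono i<j) (proj₂ BS j)
  ... | inj₂ refl = proj₂ BS i

  ≺-or-≻ : ∀ {i j} → i ≢ j → B i ≺ B j ⊎ B j ≺ B i
  ≺-or-≻ {i} {j} i≢j with <-cmp i j
  ... | tri< i<j _ _ = inj₁ (≺-mono i<j)
  ... | tri≈ _ i≡j _ = contradiction i≡j i≢j
  ... | tri> _ _ j<i = inj₂ (≺-mono j<i)

  hull-disjoint : ∀ {i j x} → i ≢ j → Hull (B j) x → B i x ≡ 0
  hull-disjoint {i} {j} {x} i≢j ((y , y≤x , Bjy≢0) , (y′ , x≤y′ , Bjy′≢0)) =
    decidable-stable (B i x ≟ 0) λ Bix≢0 →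
      [ (λ i≺j → <⇒≱ (i≺j x y Bix≢0 Bjy≢0) y≤x)
      , (λ j≺i → <⇒≱ (j≺i y′ x Bjy′≢0 Bix≢0) x≤y′)
      ] (≺-or-≻ i≢j)

  split-left : ∀ {j a} → B j a ≢ 0 →
               ∀ i → i ≢ j → Supp (B i) ⊆ (_< a) ⊎ Supp (B i) ⊆ ∁ (_< a)
  split-left {a = a} Bja≢0 i i≢j =
    Sum.map (λ i≺j {x} Bix≢0 → i≺j x a Bix≢0 Bja≢0)
            (λ j≺i {x} Bix≢0 x<a → <-asym x<a (j≺i a x Bja≢0 Bix≢0))
            (≺-or-≻ i≢j)

  split-right : ∀ {j b} → B j b ≢ 0 →
                ∀ i → i ≢ j → Supp (B i) ⊆ (b <_) ⊎ Supp (B i) ⊆ ∁ (b <_)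
  split-right {b = b} Bjb≢0 i i≢j =
    Sum.swap (Sum.map (λ i≺j {x} Bix≢0 b<x → <-asym b<x (i≺j x b Bix≢0 Bjb≢0))
                      (λ j≺i {x} Bix≢0 → j≺i b x Bjb≢0 Bix≢0)
                      (≺-or-≻ i≢j))

  rep-local : ∀ {m} (r : Rep k B m) a → Hull (B (Rep.idx r a)) ⊆ λ x → m x ≡ Rep.term r a x
  rep-local r a {x} hull =
    trans (Rep.eq r x) (sumF-single (Rep.len r) (Rep.term r) a λ b b≢a →
      m≡0⇒m∸n≡0 (Rep.ex r b) (hull-disjoint (strictMono⇒injective (Rep.idx-mono r) b≢a) hull))

  rep-local-block : ∀ {m} (r : Rep k B m) i → ∃[ e ] (Hull (B i) ⊆ λ x → m x ≡ T^ e (B i) x)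
  rep-local-block r i with FP.any? (λ a → Rep.idx r a ≟ i)
  ... | yes (a , refl) = Rep.ex r a , rep-local r a
  ... | no absent = k , λ {x} hull →  -- B i does not occur: m = 0 = T^ k (B i) on its hull
    trans (Rep.eq r x) (trans
      (sumF-≡0 (Rep.len r) (Rep.term r) λ b →
        m≡0⇒m∸n≡0 (Rep.ex r b) (hull-disjoint (λ idx≡i → absent (b , idx≡i)) hull))
      (sym (m≤n⇒m∸n≡0 (B≤k i x))))

  rep-finite : ∀ {m} → Rep k B m → Finite m
  rep-finite r
    with sumF-finite (Rep.len r) (Rep.term r) (λ a → T^-finite (Rep.ex r a) (B-finite (Rep.idx r a)))
  ... | N , vanish = N , λ x N≤x → trans (Rep.eq r x) (vanish x N≤x)

  rep-nonempty : ∀ {m} → Rep k B m → ∃[ y ] m y ≢ 0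
  rep-nonempty {m} r with Rep.ex-min r
  ... | a , ex≡0 with B-nonempty (Rep.idx r a)
  ... | y , By≢0 = y , λ my≡0 → By≢0 (begin
      B (Rep.idx r a) y               ≡⟨ cong (B (Rep.idx r a) y ∸_) (sym ex≡0) ⟩
      Rep.term r a y                  ≡⟨ sym (rep-local r a (supp⊆hull By≢0)) ⟩
      m y                             ≡⟨ my≡0 ⟩
      0                               ∎)
    where open ≡-Reasoning

  -- Like Rep, but possibly empty and with no exponent required to be 0, so that dropping terms
  -- stays inside the type; indices are at least lo and strictly increasing.
  data Comb (lo : ℕ) : Set where
    []   : Comb lo
    cons : ∀ i e → lo ≤ i → e < k → Comb (suc i) → Comb lo

  ⟦_⟧ : ∀ {lo} → Comb lo → Map
  ⟦ [] ⟧ _ = 0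
  ⟦ cons i e _ _ c ⟧ = T^ e (B i) ⊕ ⟦ c ⟧

  len : ∀ {lo} → Comb lo → ℕ
  len [] = 0
  len (cons _ _ _ _ c) = suc (len c)

  idx ex : ∀ {lo} (c : Comb lo) → Fin (len c) → ℕ
  idx (cons i _ _ _ _) F.zero = i
  idx (cons _ _ _ _ c) (F.suc a) = idx c a
  ex (cons _ e _ _ _) F.zero = e
  ex (cons _ _ _ _ c) (F.suc a) = ex c a

  lo≤idx : ∀ {lo} (c : Comb lo) a → lo ≤ idx c a
  lo≤idx (cons _ _ lo≤i _ _) F.zero = lo≤i
  lo≤idx (cons _ _ lo≤i _ c) (F.suc a) = ≤-trans lo≤i (<⇒≤ (lo≤idx c a))

  idx-mono : ∀ {lo} (c : Comb lo) a b → a F.< b → idx c a < idx c b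
  idx-mono (cons _ _ _ _ c) F.zero (F.suc b) _ = lo≤idx c b
  idx-mono (cons _ _ _ _ c) (F.suc a) (F.suc b) (s≤s a<b) = idx-mono c a b a<b

  ex<k : ∀ {lo} (c : Comb lo) a → ex c a < k
  ex<k (cons _ _ _ e<k _) F.zero = e<k
  ex<k (cons _ _ _ _ c) (F.suc a) = ex<k c a

  ⟦⟧≐sumF : ∀ {lo} (c : Comb lo) →
            ⟦ c ⟧ ≐ sumF (len c) (λ a → T^ (ex c a) (B (idx c a)))
  ⟦⟧≐sumF [] _ = refl
  ⟦⟧≐sumF (cons i e _ _ c) x = cong (T^ e (B i) x +_) (⟦⟧≐sumF c x)

  toRep : ∀ {lo} (c : Comb lo) → ∃[ a ] ex c a ≡ 0 → Rep k B ⟦ c ⟧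
  toRep c ex-min = record
    { len = len c ; idx = idx c ; ex = ex c ; idx-mono = idx-mono c
    ; ex<k = ex<k c ; ex-min = ex-min ; eq = ⟦⟧≐sumF c }

  fromSum : ∀ {lo} n (idx ex : Fin n → ℕ) → (∀ a b → a F.< b → idx a < idx b) →
            (∀ a → lo ≤ idx a) → (∀ a → ex a < k) →
            Σ[ c ∈ Comb lo ] ⟦ c ⟧ ≐ sumF n (λ a → T^ (ex a) (B (idx a)))
  fromSum zero _ _ _ _ _ = [] , λ _ → refl
  fromSum (suc n) idx ex mono lo≤idx ex<k
    with fromSum n (idx ∘ F.suc) (ex ∘ F.suc) (λ a b a<b → mono (F.suc a) (F.suc b) (s≤s a<b))
                   (λ a → mono F.zero (F.suc a) (s≤s z≤n)) (ex<k ∘ F.suc)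
  ... | c , eq = cons (idx F.zero) (ex F.zero) (lo≤idx F.zero) (ex<k F.zero) c ,
                 λ x → cong (T^ (ex F.zero) (B (idx F.zero)) x +_) (eq x)

  fromRep : ∀ {m} → Rep k B m → Σ[ c ∈ Comb 0 ] m ≐ ⟦ c ⟧
  fromRep r
    with fromSum (Rep.len r) (Rep.idx r) (Rep.ex r) (Rep.idx-mono r) (λ _ → z≤n) (Rep.ex<k r)
  ... | c , eq = c , λ x → trans (Rep.eq r x) (sym (eq x))

  ⟦⟧-vanishes : ∀ {lo i x} (c : Comb lo) → i < lo → B i x ≢ 0 → ⟦ c ⟧ x ≡ 0
  ⟦⟧-vanishes [] _ _ = refl
  ⟦⟧-vanishes {i = i} {x} (cons j e lo≤j _ c) i<lo Bix≢0 =
    cong₂ _+_ (m≡0⇒m∸n≡0 e Bjx≡0) (⟦⟧-vanishes c (m<n⇒m<1+n i<j) Bix≢0)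
    where
      i<j = <-≤-trans i<lo lo≤j
      Bjx≡0 : B j x ≡ 0
      Bjx≡0 = decidable-stable (B j x ≟ 0) λ Bjx≢0 →
        <-irrefl refl (≺-mono i<j x x Bix≢0 Bjx≢0)

  head-disjoint : ∀ {i} e (c : Comb (suc i)) → Disjoint (T^ e (B i)) ⟦ c ⟧
  head-disjoint {i} e c x with B i x ≟ 0
  ... | yes Bix≡0 = inj₁ (m≡0⇒m∸n≡0 e Bix≡0)
  ... | no Bix≢0 = inj₂ (⟦⟧-vanishes c ≤-refl Bix≢0)

  minEx : ∀ {lo} → Comb lo → ℕ
  minEx [] = k  -- neutral for _⊓_ on exponents, which are all < k
  minEx (cons _ e _ _ c) = e ⊓ minEx c

  lower : ∀ {lo} → ℕ → Comb lo → Comb lo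
  lower m [] = []
  lower m (cons i e lo≤i e<k c) = cons i (e ∸ m) lo≤i (≤-<-trans (m∸n≤m e m) e<k) (lower m c)

  lower-attains-0 : ∀ {lo m} (c : Comb lo) → minEx c ≤ m → m < k →
                    ∃[ a ] ex (lower m c) a ≡ 0
  lower-attains-0 [] k≤m m<k = contradiction k≤m (<⇒≱ m<k)
  lower-attains-0 (cons _ e _ _ c) min≤m m<k with ⊓-sel e (minEx c)
  ... | inj₁ min≡e = F.zero , m≤n⇒m∸n≡0 (subst (_≤ _) min≡e min≤m)
  ... | inj₂ min≡minEx with lower-attains-0 c (subst (_≤ _) min≡minEx min≤m) m<k
  ...   | a , ex≡0 = F.suc a , ex≡0

  ⟦⟧-lower : ∀ {lo m} (c : Comb lo) → m ≤ minEx c → ⟦ c ⟧ ≐ T^ m ⟦ lower m c ⟧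
  ⟦⟧-lower {m = m} [] _ _ = sym (0∸n≡0 m)
  ⟦⟧-lower {m = m} (cons i e _ _ c) m≤min x = begin
      T^ e (B i) x + ⟦ c ⟧ x
    ≡⟨ cong₂ _+_ (sym (T^-T^ (B i) (m≤n⊓o⇒m≤n e (minEx c) m≤min) x))
                 (⟦⟧-lower c (m≤n⊓o⇒m≤o e (minEx c) m≤min) x) ⟩
      T^ m (T^ (e ∸ m) (B i)) x + T^ m ⟦ lower m c ⟧ x
    ≡⟨ sym (T^-⊕ m (head-disjoint (e ∸ m) (lower m c)) x) ⟩
      T^ m (T^ (e ∸ m) (B i) ⊕ ⟦ lower m c ⟧) x
    ∎
    where open ≡-Reasoning

  comb-in-span* : ∀ {lo} (c : Comb lo) → InSpan* k B ⟦ c ⟧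
  comb-in-span* [] = k , ⟦ b₀ ⟧ , toRep b₀ (F.zero , refl) ,
    λ x → sym (m≤n⇒m∸n≡0 (≤-trans (≤-reflexive (+-identityʳ (B 0 x))) (B≤k 0 x)))
    where
      b₀ : Comb 0
      b₀ = cons 0 0 z≤n 1≤k []
  comb-in-span* c@(cons _ e _ e<k _) =
    minEx c , ⟦ lower (minEx c) c ⟧ ,
    toRep (lower (minEx c) c) (lower-attains-0 c ≤-refl (m<n⇒m⊓o<n _ e<k)) ,
    ⟦⟧-lower c ≤-refl

  weaken : ∀ {lo lo′} → lo ≤ lo′ → Comb lo′ → Comb lo
  weaken _ [] = []
  weaken lo≤lo′ (cons i e lo′≤i e<k c) = cons i e (≤-trans lo≤lo′ lo′≤i) e<k c

  ⟦weaken⟧ : ∀ {lo lo′} (lo≤lo′ : lo ≤ lo′) (c : Comb lo′) →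
             ⟦ weaken lo≤lo′ c ⟧ ≐ ⟦ c ⟧
  ⟦weaken⟧ _ [] _ = refl
  ⟦weaken⟧ _ (cons _ _ _ _ _) _ = refl

  Splits : ∀ {lo} → Pred ℕ 0ℓ → Comb lo → Set
  Splits D [] = ⊤
  Splits D (cons i e _ _ c) = (Supp (T^ e (B i)) ⊆ D ⊎ Supp (T^ e (B i)) ⊆ ∁ D) × Splits D c

  restrict : ∀ {lo D} (d : Decidable D) (c : Comb lo) → Splits D c →
             Σ[ c′ ∈ Comb lo ] (⟦ c ⟧ ↾ d) ≐ ⟦ c′ ⟧
  restrict d [] _ = [] , ↾-zero d
  restrict d (cons i e lo≤i e<k c) (inj₁ inside , splits) with restrict d c splits
  ... | c′ , eq = cons i e lo≤i e<k c′ ,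
                  λ x → trans (↾-⊕-inside d inside x) (cong (T^ e (B i) x +_) (eq x))
  restrict d (cons i e lo≤i e<k c) (inj₂ outside , splits) with restrict d c splits
  ... | c′ , eq = weaken lo≤1+i c′ , λ x →
                  trans (↾-⊕-outside d outside x) (trans (eq x) (sym (⟦weaken⟧ lo≤1+i c′ x)))
    where lo≤1+i = ≤-trans lo≤i (n≤1+n i)

  splits : ∀ {lo j} {D : Pred ℕ 0ℓ} (c : Comb lo) →
           (∀ i → i ≢ j → Supp (B i) ⊆ D ⊎ Supp (B i) ⊆ ∁ D) →
           (∀ x → D x → B j x ≢ 0 → ⟦ c ⟧ x ≡ 0) → Splits D c
  splits [] _ _ = tt
  splits {j = j} {D} (cons i e _ _ c) side vanish =
    head-side , splits c side (λ x Dx Bjx≢0 → m+n≡0⇒n≡0 _ (vanish x Dx Bjx≢0))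
    where
      head-side : Supp (T^ e (B i)) ⊆ D ⊎ Supp (T^ e (B i)) ⊆ ∁ D
      head-side with i ≟ j
      ... | no i≢j = Sum.map (λ ⊆D tx≢0 → ⊆D (m∸n≢0⇒m≢0 e tx≢0))
                             (λ ⊆∁D tx≢0 → ⊆∁D (m∸n≢0⇒m≢0 e tx≢0)) (side i i≢j)
      ... | yes refl = inj₂ λ tx≢0 Dx →
        tx≢0 (m+n≡0⇒m≡0 _ (vanish _ Dx (m∸n≢0⇒m≢0 e tx≢0)))

  restriction-in-span* : ∀ {q j} {D : Pred ℕ 0ℓ} → Rep k B q → (d : Decidable D) →
                         (∀ i → i ≢ j → Supp (B i) ⊆ D ⊎ Supp (B i) ⊆ ∁ D) →
                         (∀ x → D x → B j x ≢ 0 → q x ≡ 0) → InSpan* k B (q ↾ d)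
  restriction-in-span* r d side vanish with fromRep r
  ... | c , q≐c
    with restrict d c (splits c side λ x Dx Bjx≢0 → trans (sym (q≐c x)) (vanish x Dx Bjx≢0))
  ...   | c′ , eq = InSpan*-resp (λ x → trans (↾-cong d q≐c x) (eq x)) (comb-in-span* c′)

module Decomposition {k : ℕ} (1≤k : 1 ≤ k)
                     {P Q : ℕ → Map} (BP : BlockSeq k P) (BQ : BlockSeq k Q)
                     {p : Map} (rP : Rep k P p) (rQ : Rep k Q p) (connected : Connected rP rQ)
                     {q : Map} (qP : Rep k P q) (qQ : Rep k Q q) where

  module ⟨P⟩ = BlockSequence 1≤k BP
  module ⟨Q⟩ = BlockSequence 1≤k BQ

  Vertex : Set
  Vertex = Fin (Rep.len rP) ⊎ Fin (Rep.len rQ)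

  block : Vertex → Map
  block (inj₁ a) = P (Rep.idx rP a)
  block (inj₂ b) = Q (Rep.idx rQ b)

  p-exp q-exp : Vertex → ℕ
  p-exp (inj₁ a) = Rep.ex rP a
  p-exp (inj₂ b) = Rep.ex rQ b
  q-exp (inj₁ a) = proj₁ (⟨P⟩.rep-local-block qP (Rep.idx rP a))
  q-exp (inj₂ b) = proj₁ (⟨Q⟩.rep-local-block qQ (Rep.idx rQ b))

  term : Vertex → Map
  term u = T^ (p-exp u) (block u)

  p-local : ∀ u → Hull (block u) ⊆ λ x → p x ≡ term u x
  p-local (inj₁ a) = ⟨P⟩.rep-local rP a
  p-local (inj₂ b) = ⟨Q⟩.rep-local rQ b

  q-local : ∀ u → Hull (block u) ⊆ λ x → q x ≡ T^ (q-exp u) (block u) x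
  q-local (inj₁ a) = proj₂ (⟨P⟩.rep-local-block qP (Rep.idx rP a))
  q-local (inj₂ b) = proj₂ (⟨Q⟩.rep-local-block qQ (Rep.idx rQ b))

  edge-overlaps : ∀ {u w} → Edge rP rQ u w → ∃[ z ] (term u z ≢ 0 × term w z ≢ 0)
  edge-overlaps {inj₁ _} {inj₂ _} (z , tu , tw) = z , tu , tw
  edge-overlaps {inj₂ _} {inj₁ _} (z , tw , tu) = z , tu , tw
  edge-overlaps {inj₁ _} {inj₁ _} ()
  edge-overlaps {inj₂ _} {inj₂ _} ()

  q-exp<p-exp⇒p<q : ∀ u {z} → term u z ≢ 0 → q-exp u < p-exp u → p z < q z
  q-exp<p-exp⇒p<q u {z} tz≢0 q-exp<p-exp =
    subst₂ _<_ (sym (p-local u hull)) (sym (q-local u hull))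
      (∸-monoʳ-< q-exp<p-exp (<⇒≤ (m∸n≢0⇒n<m tz≢0)))
    where hull = supp⊆hull (m∸n≢0⇒m≢0 (p-exp u) tz≢0)

  p<q⇒q-exp<p-exp : ∀ u {z} → Hull (block u) z → p z < q z → q-exp u < p-exp u
  p<q⇒q-exp<p-exp u {z} hull pz<qz = ≰⇒> λ p-exp≤q-exp →
    <⇒≱ (subst₂ _<_ (p-local u hull) (q-local u hull) pz<qz)
        (∸-monoʳ-≤ (block u z) p-exp≤q-exp)

  q-exp<p-exp-along-edge : ∀ {u w} → Edge rP rQ u w → q-exp u < p-exp u → q-exp w < p-exp w
  q-exp<p-exp-along-edge {u} {w} edge lt with edge-overlaps edge
  ... | z , tuz≢0 , twz≢0 =
    p<q⇒q-exp<p-exp w (supp⊆hull (m∸n≢0⇒m≢0 (p-exp w) twz≢0))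
                      (q-exp<p-exp⇒p<q u tuz≢0 lt)

  q-exp<p-exp-along-path : ∀ {u v} → Star (Edge rP rQ) u v →
                           q-exp u < p-exp u → q-exp v < p-exp v
  q-exp<p-exp-along-path ε = id
  q-exp<p-exp-along-path (edge ◅ path) = q-exp<p-exp-along-path path ∘ q-exp<p-exp-along-edge edge

  p-exp≤q-exp : ∀ u → p-exp u ≤ q-exp u
  p-exp≤q-exp u with Rep.ex-min rP
  ... | a₀ , ex≡0 = ≮⇒≥ λ lt →
    n≮0 (subst (q-exp (inj₁ a₀) <_) ex≡0 (q-exp<p-exp-along-path (connected u (inj₁ a₀)) lt))

  q≤p-near : ∀ u → Hull (block u) ⊆ λ x → q x ≤ p x
  q≤p-near u {x} hull =
    subst₂ _≤_ (sym (q-local u hull)) (sym (p-local u hull))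
      (∸-monoʳ-≤ (block u x) (p-exp≤q-exp u))

  vertex-at : ∀ {y} → p y ≢ 0 → ∃[ u ] term u y ≢ 0
  vertex-at py≢0 with rep-supp rP py≢0
  ... | a , term≢0 = inj₁ a , term≢0

  q≤p-on-hull : Hull p ⊆ λ x → q x ≤ p x
  q≤p-on-hull ((y , y≤x , py≢0) , (y′ , x≤y′ , py′≢0))
    with vertex-at py≢0 | vertex-at py′≢0
  ... | u , tuy≢0 | v , tvy′≢0
    with hull-along-path term edge-overlaps (connected u v)
           (y , y≤x , tuy≢0) (y′ , x≤y′ , tvy′≢0)
  ...   | w , hull = q≤p-near w (T^-hull {p-exp w} hull)

  leftmost : ∃[ a ] (p a ≢ 0 × ∀ x → x < a → p x ≡ 0)
  leftmost = least-supp p (proj₂ (⟨P⟩.rep-nonempty rP))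

  rightmost : ∃[ b ] (p b ≢ 0 × ∀ x → b < x → p x ≡ 0)
  rightmost with ⟨P⟩.rep-finite rP
  ... | N , vanish = greatest-supp p N vanish (proj₂ (⟨P⟩.rep-nonempty rP))

  a b : ℕ
  a = proj₁ leftmost
  b = proj₁ rightmost

  pa≢0 : p a ≢ 0
  pa≢0 = proj₁ (proj₂ leftmost)

  pb≢0 : p b ≢ 0
  pb≢0 = proj₁ (proj₂ rightmost)

  p-left-of-a : ∀ x → x < a → p x ≡ 0
  p-left-of-a = proj₂ (proj₂ leftmost)

  p-right-of-b : ∀ x → b < x → p x ≡ 0
  p-right-of-b = proj₂ (proj₂ rightmost)

  a≤supp : ∀ {y} → p y ≢ 0 → a ≤ y
  a≤supp {y} py≢0 = ≮⇒≥ λ y<a → py≢0 (p-left-of-a y y<a)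

  supp≤b : ∀ {y} → p y ≢ 0 → y ≤ b
  supp≤b {y} py≢0 = ≮⇒≥ λ b<y → py≢0 (p-right-of-b y b<y)

  s r : Map
  s = q ↾ (_<? a)
  r = q ↾ (b <?_)

  s≺p : s ≺ p
  s≺p x y sx≢0 py≢0 with x <? a
  ... | yes x<a = <-≤-trans x<a (a≤supp py≢0)
  ... | no _ = contradiction refl sx≢0

  p≺r : p ≺ r
  p≺r x y px≢0 ry≢0 with b <? y
  ... | yes b<y = ≤-<-trans (supp≤b px≢0) b<y
  ... | no _ = contradiction refl ry≢0

  ⋆-decomposition : (p ⋆ q) ≐ ((s ⊕ p) ⊕ r)
  ⋆-decomposition x with x <? a | b <? x
  ... | yes x<a | yes b<x = contradiction (≤-<-trans (supp≤b pa≢0) b<x) (<-asym x<a)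
  ... | yes x<a | no _ rewrite p-left-of-a x x<a = sym (trans (+-identityʳ _) (+-identityʳ _))
  ... | no _ | yes b<x rewrite p-right-of-b x b<x = refl
  ... | no x≮a | no b≮x = trans (m≥n⇒m⊔n≡m (q≤p-on-hull hull)) (sym (+-identityʳ _))
    where hull = (a , ≮⇒≥ x≮a , pa≢0) , (b , ≮⇒≥ b≮x , pb≢0)

  q-left-of-a : ∀ u → block u a ≢ 0 → ∀ x → x < a → block u x ≢ 0 → q x ≡ 0
  q-left-of-a u ua≢0 x x<a ux≢0 =
    n≤0⇒n≡0 (subst (q x ≤_) (p-left-of-a x x<a)
                   (q≤p-near u ((x , ≤-refl , ux≢0) , (a , <⇒≤ x<a , ua≢0))))

  q-right-of-b : ∀ u → block u b ≢ 0 → ∀ x → b < x → block u x ≢ 0 → q x ≡ 0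
  q-right-of-b u ub≢0 x b<x ux≢0 =
    n≤0⇒n≡0 (subst (q x ≤_) (p-right-of-b x b<x)
                   (q≤p-near u ((b , <⇒≤ b<x , ub≢0) , (x , ≤-refl , ux≢0))))

  s∈⟨P⟩* : InSpan* k P s
  s∈⟨P⟩* with rep-supp rP pa≢0
  ... | α , tα≢0 =
    ⟨P⟩.restriction-in-span* qP (_<? a) (⟨P⟩.split-left Pα≢0) (q-left-of-a (inj₁ α) Pα≢0)
    where Pα≢0 = m∸n≢0⇒m≢0 (Rep.ex rP α) tα≢0

  s∈⟨Q⟩* : InSpan* k Q s
  s∈⟨Q⟩* with rep-supp rQ pa≢0
  ... | β , tβ≢0 =
    ⟨Q⟩.restriction-in-span* qQ (_<? a) (⟨Q⟩.split-left Qβ≢0) (q-left-of-a (inj₂ β) Qβ≢0)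
    where Qβ≢0 = m∸n≢0⇒m≢0 (Rep.ex rQ β) tβ≢0

  r∈⟨P⟩* : InSpan* k P r
  r∈⟨P⟩* with rep-supp rP pb≢0
  ... | α , tα≢0 =
    ⟨P⟩.restriction-in-span* qP (b <?_) (⟨P⟩.split-right Pα≢0) (q-right-of-b (inj₁ α) Pα≢0)
    where Pα≢0 = m∸n≢0⇒m≢0 (Rep.ex rP α) tα≢0

  r∈⟨Q⟩* : InSpan* k Q r
  r∈⟨Q⟩* with rep-supp rQ pb≢0
  ... | β , tβ≢0 =
    ⟨Q⟩.restriction-in-span* qQ (b <?_) (⟨Q⟩.split-right Qβ≢0) (q-right-of-b (inj₂ β) Qβ≢0)
    where Qβ≢0 = m∸n≢0⇒m≢0 (Rep.ex rQ β) tβ≢0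

lemma3p6 : (k : ℕ) → 1 ≤ k → (P Q : ℕ → Map) → BlockSeq k P → BlockSeq k Q →
    (p : Map) → InSpan k P p → InSpan k Q p → Intertwined k P Q p →
    (q : Map) → InSpan k P q → InSpan k Q q →
    ∃[ s ] ∃[ r ] (InSpan* k P s × InSpan* k Q s × InSpan* k P r × InSpan* k Q r ×
      s ≺ p × p ≺ r × (p ⋆ q) ≐ ((s ⊕ p) ⊕ r))
lemma3p6 k 1≤k P Q BP BQ p _ _ (rP , rQ , connected) q qP qQ =
  s , r , s∈⟨P⟩* , s∈⟨Q⟩* , r∈⟨P⟩* , r∈⟨Q⟩* , s≺p , p≺r , ⋆-decomposition
  where open Decomposition 1≤k BP BQ rP rQ connected qP qQ
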